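{- Let $G=(V,E)$ be a finite simple undirected graph. Construct a vertex-colored graph $G'=(V',E')$ as follows: $V'$ consists of the base vertices $V$, each with its own distinct color, together with, for every unordered pair of distinct vertices $u,v\in V$ with $(u,v)\notin E$, two additional vertices $u_v$ and $v_u$ which receive the same color, a color used by no other vertex; $E'$ consists of $E$ together with the edges $(u_v,u)$ and $(v_u,v)$ for each such non-adjacent pair. If the optimal value of the Minimum Colorful Components problem on $G'$ is $k$, then $V$ can be partitioned into $k$ sets each inducing a complete subgraph (clique) of $G$.
   Context: Minimum Colorful Components (MCC) problem: given a vertex-colored simple undirected graph, delete a set of edges so that every connected component of the remaining graph is colorful (no two vertices of the same color); the cost is the number of connected components of the remaining graph, to be minimized. -}

module Defs where

open import Data.Nat using (ℕ; _≤_; _≤ᵇ_)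
open import Data.Fin using (Fin; toℕ)
open import Data.Bool using (Bool; true; false; if_then_else_)
open import Data.Product using (Σ; _×_; _,_)
open import Relation.Binary.PropositionalEquality using (_≡_; _≢_)
open import Relation.Binary.Construct.Closure.ReflexiveTransitive using (Star)
open import Function.Definitions using (Surjective)
open import Function.Bundles using (_⇔_)

record SimpleGraph (n : ℕ) : Set where
  field
    adj   : Fin n → Fin n → Bool
    sym   : ∀ u v → adj u v ≡ adj v u
    irrfl : ∀ u → adj u u ≡ false
open SimpleGraph public

module Construction {n : ℕ} (G : SimpleGraph n) where

  -- Vertices of G'.  'base u' is the original vertex u; 'aux u v' is the
  -- vertex u_v, existing exactly when u ≠ v and (u,v) is not an edge.
  -- For a non-adjacent unordered pair {u,v} this gives u_v = aux u v and
  -- v_u = aux v u.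
  data V' : Set where
    base : Fin n → V'
    aux  : (u v : Fin n) → .(u ≢ v) → .(adj G u v ≡ false) → V'

  data Colour : Set where
    cbase : Fin n → Colour
    cpair : Fin n → Fin n → Colour

  colour : V' → Colour
  colour (base u) = cbase u
  colour (aux u v _ _) = if toℕ u ≤ᵇ toℕ v then cpair u v else cpair v u

  -- Edges of G' (given in both orientations; the graph is undirected).
  data E' : V' → V' → Set where
    eBase  : ∀ {u v} → adj G u v ≡ true → E' (base u) (base v)
    eAux₁  : ∀ {u v} .{p : u ≢ v} .{q : adj G u v ≡ false} →
             E' (aux u v p q) (base u)
    eAux₂  : ∀ {u v} .{p : u ≢ v} .{q : adj G u v ≡ false} →
             E' (base u) (aux u v p q)

  HasComponents : (F : V' → V' → Set) → ℕ → Set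
  HasComponents F c =
    Σ (V' → Fin c) λ comp →
      Surjective _≡_ _≡_ comp ×
      (∀ x y → (comp x ≡ comp y) ⇔ Star F x y)

  AllColourful : (F : V' → V' → Set) → Set
  AllColourful F = ∀ x y → Star F x y → colour x ≡ colour y → x ≡ y

  Feasible : ℕ → Set₁
  Feasible c =
    Σ (V' → V' → Set) λ F →
      (∀ x y → F x y → E' x y) ×
      (∀ x y → F x y → F y x) ×
      AllColourful F ×
      HasComponents F c

  MCCOptimum : ℕ → Set₁
  MCCOptimum k = Feasible k × (∀ c → Feasible c → k ≤ c)

CliquePartition : {n : ℕ} → SimpleGraph n → ℕ → Set
CliquePartition {n} G k =
  Σ (Fin n → Fin k) λ f →
    Surjective _≡_ _≡_ f ×
    (∀ u v → f u ≡ f v → u ≢ v → adj G u v ≡ true)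

-- A partition of V into p cliques yields an MCC solution of G' with p components:
-- keep the edges of G inside each clique and attach every u_v to u exactly when u
-- and v lie in different cliques.  Conversely, take an optimal solution with k
-- components.  If u and v are non-adjacent but in the same component, u_v and v_u
-- have the same colour, so one of them is cut off from its only neighbour and forms
-- a singleton component.  Giving the larger of u, v that singleton as its label, and
-- every other vertex its own component, labels V by the k components so that each
-- label class is a clique; the classes actually used are at most k cliques
-- partitioning V, and optimality forces their number to be exactly k.
module Submission where

open import Defs hiding (sym)
open import Data.Bool using (true; false)
import Data.Bool as Bool
open import Data.Empty using (⊥-elim)
import Data.Empty.Irrelevant as Irrelevant
open import Data.Fin using (Fin; zero; suc; toℕ; _≟_; _<_)
open import Data.Fin.Properties using (any?; <-cmp; <-asym; <⇒≢; _<?_; toℕ-injective; injective⇒≤)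
open import Data.Nat using (ℕ; _≤_; _≤ᵇ_)
import Data.Nat.Properties as ℕ
open import Data.Product using (Σ; ∃; _×_; _,_; proj₁)
open import Data.Sum using (_⊎_; inj₁; inj₂)
open import Function using (_∘_)
open import Function.Bundles using (_⇔_; mk⇔; Equivalence)
open import Function.Definitions using (Injective; Surjective; StrictlySurjective)
open import Function.Consequences.Propositional using (strictlySurjective⇒surjective)
open import Relation.Binary using (tri<; tri≈; tri>)
open import Relation.Binary.PropositionalEquality using (_≡_; _≢_; refl; sym; trans; cong; subst)
open import Relation.Binary.Construct.Closure.ReflexiveTransitive using (Star; ε; _◅_; _◅◅_)
open import Relation.Nullary using (Dec; yes; no)
open import Relation.Nullary.Decidable using (_×-dec_; recompute)
open import Relation.Nullary.Reflects using (ofʸ; ofⁿ)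

record Image {n k : ℕ} (g : Fin n → Fin k) : Set where
  field
    size            : ℕ
    onto            : Fin n → Fin size
    into            : Fin size → Fin k
    onto-surjective : StrictlySurjective _≡_ onto
    into-injective  : Injective _≡_ _≡_ into
    factorises      : ∀ x → into (onto x) ≡ g x

image : ∀ {n k} (g : Fin n → Fin k) → Image g
image {ℕ.zero} g = record
  { size = 0 ; onto = λ () ; into = λ () ; onto-surjective = λ ()
  ; into-injective = λ {} ; factorises = λ () }
image {ℕ.suc n} {k} g with image (g ∘ suc) | any? (λ x → g (suc x) ≟ g zero)
... | I | yes (x₀ , gx₀≡g0) = record
  { size = size ; onto = onto′ ; into = into ; onto-surjective = onto′-surjective
  ; into-injective = into-injective ; factorises = factorises′ }
  where
  open Image I
  onto′ : Fin (ℕ.suc n) → Fin size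
  onto′ zero    = onto x₀
  onto′ (suc x) = onto x

  onto′-surjective : StrictlySurjective _≡_ onto′
  onto′-surjective i with onto-surjective i
  ... | x , ontox≡i = suc x , ontox≡i

  factorises′ : ∀ x → into (onto′ x) ≡ g x
  factorises′ zero    = trans (factorises x₀) gx₀≡g0
  factorises′ (suc x) = factorises x
... | I | no fresh = record
  { size = ℕ.suc size ; onto = onto′ ; into = into′ ; onto-surjective = onto′-surjective
  ; into-injective = into′-injective ; factorises = factorises′ }
  where
  open Image I
  onto′ : Fin (ℕ.suc n) → Fin (ℕ.suc size)
  onto′ zero    = zero
  onto′ (suc x) = suc (onto x)

  into′ : Fin (ℕ.suc size) → Fin k
  into′ zero    = g zero
  into′ (suc i) = into i

  onto′-surjective : StrictlySurjective _≡_ onto′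
  onto′-surjective zero = zero , refl
  onto′-surjective (suc i) with onto-surjective i
  ... | x , ontox≡i = suc x , cong suc ontox≡i

  old-image-misses-g0 : ∀ i → into i ≢ g zero
  old-image-misses-g0 i intoi≡g0 with onto-surjective i
  ... | x , refl = fresh (x , trans (sym (factorises x)) intoi≡g0)

  into′-injective : Injective _≡_ _≡_ into′
  into′-injective {zero}  {zero}  _   = refl
  into′-injective {zero}  {suc j} eq  = ⊥-elim (old-image-misses-g0 j (sym eq))
  into′-injective {suc i} {zero}  eq  = ⊥-elim (old-image-misses-g0 i eq)
  into′-injective {suc i} {suc j} eq  = cong suc (into-injective eq)

  factorises′ : ∀ x → into′ (onto′ x) ≡ g x
  factorises′ zero    = refl
  factorises′ (suc x) = factorises x

CliqueLabelling : {n : ℕ} → SimpleGraph n → ℕ → Set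
CliqueLabelling {n} G k =
  Σ (Fin n → Fin k) λ f → ∀ u v → f u ≡ f v → u ≢ v → adj G u v ≡ true

cliqueLabelling⇒cliquePartition : ∀ {n k} (G : SimpleGraph n) →
  CliqueLabelling G k → ∃ λ p → p ≤ k × CliquePartition G p
cliqueLabelling⇒cliquePartition G (g , g-cliques) =
  size , injective⇒≤ into-injective ,
  onto , strictlySurjective⇒surjective onto-surjective , onto-cliques
  where
  open Image (image g)
  onto-cliques : ∀ u v → onto u ≡ onto v → u ≢ v → adj G u v ≡ true
  onto-cliques u v same =
    g-cliques u v (trans (sym (factorises u)) (trans (cong into same) (factorises v)))

module _ {n : ℕ} (G : SimpleGraph n) where
  open Construction G

  owner : V' → Fin n
  owner (base u)      = u
  owner (aux u _ _ _) = u

  data AuxOf (u v : Fin n) : V' → Set where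
    this : .{p : u ≢ v} .{q : adj G u v ≡ false} → AuxOf u v (aux u v p q)
    that : .{p : v ≢ u} .{q : adj G v u ≡ false} → AuxOf u v (aux v u p q)

  auxOf-larger-unique : ∀ {u v w v′ a} →
    AuxOf u v a → AuxOf w v′ a → v < u → v′ < w → u ≡ w
  auxOf-larger-unique this this _   _    = refl
  auxOf-larger-unique this that v<u v′<w = ⊥-elim (<-asym v<u v′<w)
  auxOf-larger-unique that this v<u v′<w = ⊥-elim (<-asym v<u v′<w)
  auxOf-larger-unique that that _   _    = refl

  E'-sym : ∀ {x y} → E' x y → E' y x
  E'-sym (eBase {u} {v} e) = eBase (trans (SimpleGraph.sym G v u) e)
  E'-sym eAux₁             = eAux₂
  E'-sym eAux₂             = eAux₁

  colour-aux-swap : ∀ {u v} .{p : u ≢ v} .{q : adj G u v ≡ false}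
    .{p′ : v ≢ u} .{q′ : adj G v u ≡ false} →
    colour (aux u v p q) ≡ colour (aux v u p′ q′)
  colour-aux-swap {u} {v} {p}
    with toℕ u ≤ᵇ toℕ v | ℕ.≤ᵇ-reflects-≤ (toℕ u) (toℕ v)
       | toℕ v ≤ᵇ toℕ u | ℕ.≤ᵇ-reflects-≤ (toℕ v) (toℕ u)
  ... | true  | _        | false | _        = refl
  ... | false | _        | true  | _        = refl
  ... | true  | ofʸ u≤v  | true  | ofʸ v≤u  = Irrelevant.⊥-elim (p (toℕ-injective (ℕ.≤-antisym u≤v v≤u)))
  ... | false | ofⁿ u≰v  | false | ofⁿ v≰u  = ⊥-elim (u≰v (ℕ.≰⇒≥ v≰u))

  recover-non-edge : ∀ {u v} → .(u ≢ v) → .(adj G u v ≡ false) → u ≢ v × adj G u v ≡ false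
  recover-non-edge {u} {v} p q =
    (λ e → Irrelevant.⊥-elim (p e)) , recompute (adj G u v Bool.≟ false) q

  same-colour : ∀ x y → colour x ≡ colour y →
    x ≡ y ⊎ (owner x ≢ owner y × adj G (owner x) (owner y) ≡ false)
  same-colour (base u) (base .u) refl = inj₁ refl
  same-colour (base u) (aux v w _ _) c with toℕ v ≤ᵇ toℕ w | c
  ... | true  | ()
  ... | false | ()
  same-colour (aux v w _ _) (base u) c with toℕ v ≤ᵇ toℕ w | c
  ... | true  | ()
  ... | false | ()
  same-colour (aux u v p q) (aux u′ v′ _ _) c
    with toℕ u ≤ᵇ toℕ v | toℕ u′ ≤ᵇ toℕ v′ | c
  ... | true  | true  | refl = inj₁ refl
  ... | false | false | refl = inj₁ refl
  ... | true  | false | refl = inj₂ (recover-non-edge p q)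
  ... | false | true  | refl = inj₂ (recover-non-edge p q)

  cliquePartition⇒feasible : ∀ {p} → CliquePartition G p → Feasible p
  cliquePartition⇒feasible {p} (f , f-surjective , f-cliques) =
    F , (λ _ _ → proj₁) , (λ _ _ → F-sym) , colourful ,
    class , class-surjective , λ x y → mk⇔ (connected x y) path-keeps-class
    where
    class : V' → Fin p
    class = f ∘ owner

    F : V' → V' → Set
    F x y = E' x y × class x ≡ class y

    F-sym : ∀ {x y} → F x y → F y x
    F-sym (e , same) = E'-sym e , sym same

    path-keeps-class : ∀ {x y} → Star F x y → class x ≡ class y
    path-keeps-class ε                = refl
    path-keeps-class ((_ , same) ◅ r) = trans same (path-keeps-class r)

    to-owner : ∀ x → Star F x (base (owner x))
    to-owner (base _)      = ε
    to-owner (aux _ _ _ _) = (eAux₁ , refl) ◅ ε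

    from-owner : ∀ x → Star F (base (owner x)) x
    from-owner (base _)      = ε
    from-owner (aux _ _ _ _) = (eAux₂ , refl) ◅ ε

    same-clique-connected : ∀ u v → f u ≡ f v → Star F (base u) (base v)
    same-clique-connected u v same with u ≟ v
    ... | yes refl = ε
    ... | no u≢v   = (eBase (f-cliques u v same u≢v) , same) ◅ ε

    connected : ∀ x y → class x ≡ class y → Star F x y
    connected x y same =
      to-owner x ◅◅ same-clique-connected (owner x) (owner y) same ◅◅ from-owner y

    colourful : AllColourful F
    colourful x y path c with same-colour x y c
    ... | inj₁ x≡y               = x≡y
    ... | inj₂ (owners≢ , nonadj) with trans (sym nonadj) (f-cliques _ _ (path-keeps-class path) owners≢)
    ...   | ()

    class-surjective : Surjective _≡_ _≡_ class
    class-surjective i with f-surjective i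
    ... | u , fu≡i = base u , λ { refl → fu≡i refl }

  module _ {k : ℕ} (F : V' → V' → Set) (F⊆E' : ∀ x y → F x y → E' x y)
           (colourful : AllColourful F) (comp : V' → Fin k)
           (comp-classes : ∀ x y → (comp x ≡ comp y) ⇔ Star F x y) where

    connected : ∀ x y → comp x ≡ comp y → Star F x y
    connected x y = Equivalence.to (comp-classes x y)

    path-keeps-comp : ∀ {x y} → Star F x y → comp x ≡ comp y
    path-keeps-comp {x} {y} = Equivalence.from (comp-classes x y)

    Isolated : V' → Set
    Isolated a = ∀ z → comp z ≡ comp a → z ≡ a

    detached⇒isolated : ∀ {u v} .{p : u ≢ v} .{q : adj G u v ≡ false} →
      comp (aux u v p q) ≢ comp (base u) → Isolated (aux u v p q)
    detached⇒isolated {u} {v} {p} {q} detached z same = no-step (connected _ _ (sym same))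
      where
      no-step : ∀ {w} → Star F (aux u v p q) w → w ≡ aux u v p q
      no-step ε = refl
      no-step (s ◅ _) with F⊆E' _ _ s
      ... | eAux₁ = ⊥-elim (detached (path-keeps-comp (s ◅ ε)))

    isolated-aux-of-non-edge : ∀ {u v} → u ≢ v → adj G u v ≡ false →
      comp (base u) ≡ comp (base v) → Σ V' λ a → AuxOf u v a × Isolated a
    isolated-aux-of-non-edge {u} {v} u≢v nonadj same
      with comp (aux u v u≢v nonadj) ≟ comp (base u)
    ... | no detached = aux u v u≢v nonadj , this , detached⇒isolated detached
    ... | yes attached = aux v u v≢u nonadj′ , that , detached⇒isolated twins-apart
      where
      v≢u : v ≢ u
      v≢u = u≢v ∘ sym
      nonadj′ : adj G v u ≡ false
      nonadj′ = trans (SimpleGraph.sym G v u) nonadj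
      twins-apart : comp (aux v u v≢u nonadj′) ≢ comp (base v)
      twins-apart attached′ =
        u≢v (cong owner (colourful (aux u v u≢v nonadj) (aux v u v≢u nonadj′)
                          (connected _ _ (trans attached (trans same (sym attached′))))
                          (colour-aux-swap {p = u≢v} {q = nonadj} {p′ = v≢u} {q′ = nonadj′})))

    LowerNonNeighbour : Fin n → Set
    LowerNonNeighbour u = ∃ λ v → v < u × comp (base v) ≡ comp (base u) × adj G u v ≡ false

    lowerNonNeighbour? : ∀ u → Dec (LowerNonNeighbour u)
    lowerNonNeighbour? u = any? λ v →
      (v <? u) ×-dec (comp (base v) ≟ comp (base u)) ×-dec (adj G u v Bool.≟ false)

    lowerNonNeighbour-isolatedAux : ∀ {u} (c : LowerNonNeighbour u) →
      Σ V' λ a → AuxOf u (proj₁ c) a × Isolated a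
    lowerNonNeighbour-isolatedAux (v , v<u , same , nonadj) =
      isolated-aux-of-non-edge (λ u≡v → <⇒≢ v<u (sym u≡v)) nonadj (sym same)

    label′ : ∀ u → Dec (LowerNonNeighbour u) → Fin k
    label′ u (yes c) = comp (proj₁ (lowerNonNeighbour-isolatedAux c))
    label′ u (no _)  = comp (base u)

    label-cliques′ : ∀ u w (cu : Dec (LowerNonNeighbour u)) (cw : Dec (LowerNonNeighbour w)) →
      label′ u cu ≡ label′ w cw → u ≢ w → adj G u w ≡ true
    label-cliques′ u w (no ¬cu) (no ¬cw) same u≢w with adj G u w in uw
    ... | true  = refl
    ... | false with <-cmp u w
    ...   | tri< u<w _ _ = ⊥-elim (¬cw (u , u<w , same , trans (SimpleGraph.sym G w u) uw))
    ...   | tri≈ _ u≡w _ = ⊥-elim (u≢w u≡w)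
    ...   | tri> _ _ w<u = ⊥-elim (¬cu (w , w<u , sym same , uw))
    label-cliques′ u w (yes cu) (no _) same _ with lowerNonNeighbour-isolatedAux cu
    ... | a , a-aux , a-isolated with a-isolated (base w) (sym same) | a-aux
    ...   | refl | ()
    label-cliques′ u w (no _) (yes cw) same _ with lowerNonNeighbour-isolatedAux cw
    ... | a , a-aux , a-isolated with a-isolated (base u) same | a-aux
    ...   | refl | ()
    label-cliques′ u w (yes cu@(_ , v<u , _)) (yes cw@(_ , v′<w , _)) same u≢w
      with lowerNonNeighbour-isolatedAux cu | lowerNonNeighbour-isolatedAux cw
    ... | a , a-aux , _ | b , b-aux , b-isolated with b-isolated a same
    ...   | refl = ⊥-elim (u≢w (auxOf-larger-unique a-aux b-aux v<u v′<w))

    comp-cliqueLabelling : CliqueLabelling G k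
    comp-cliqueLabelling =
      label , λ u w → label-cliques′ u w (lowerNonNeighbour? u) (lowerNonNeighbour? w)
      where
      label : Fin n → Fin k
      label u = label′ u (lowerNonNeighbour? u)

feasible⇒cliqueLabelling : ∀ {n k} (G : SimpleGraph n) →
  Construction.Feasible G k → CliqueLabelling G k
feasible⇒cliqueLabelling G (F , F⊆E' , _ , colourful , comp , _ , comp-classes) =
  comp-cliqueLabelling G F F⊆E' colourful comp comp-classes

lemma7 : (n : ℕ) (G : SimpleGraph n) (k : ℕ) →
    Construction.MCCOptimum G k → CliquePartition G k
lemma7 n G k (optimal , minimal)
  with cliqueLabelling⇒cliquePartition G (feasible⇒cliqueLabelling G optimal)
... | p , p≤k , partition =
  subst (CliquePartition G) p≡k partition
  where
  p≡k : p ≡ k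
  p≡k = ℕ.≤-antisym p≤k (minimal p (cliquePartition⇒feasible G partition))
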